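{- Let $\mathcal{D}$ be a Steiner system $S(2,3,v)$ with point set $[v]$, and let $B$ and $C$ be two distinct blocks of $\mathcal{D}$. Define $I(B,C)=|N^-(B)\cap N^-(C)|$. (1) If $I(B,C)\ne0$, then $|B\cap C|=1$. (2) If $B=\{x,b,b'\}$ and $C=\{x,c,c'\}$ with $b<b'$ and $b<c<c'$, then $$I(B,C)=[c<b']+[c'<b'],$$ where $[S]=1$ if the statement $S$ holds and $[S]=0$ otherwise. (3) If $0\le i\le v-2$ and $I(B,C)\ne I(B^{(i\ i+1)},C^{(i\ i+1)})$, then $\{B,C\}=\{\{i,x,y\},\{i+1,x,z\}\}$ for some $x,y,z\in[v]$ with $y\ne z$.
   Context: $[v]=\{0,\dots,v-1\}$. An $S(2,3,v)$ is a pair $([v],\mathcal{B})$ with $\mathcal{B}\subseteq\binom{[v]}{3}$ such that every 2-subset of $[v]$ lies in exactly one block. Welter's game $\Gamma_{v,3}$ is the digraph on $\binom{[v]}{3}$ with edges $(P,(P\setminus\{p\})\cup\{q\})$ for $q<p$, $p\in P$, $q\notin P$. $N^-(P)$ denotes the set of in-neighbors of $P$ in $\Gamma_{v,3}$. For a set $B$ and a permutation $\sigma$ of $[v]$, $B^\sigma=\{b^\sigma:b\in B\}$. $(i\ i+1)$ is the transposition swapping $i$ and $i+1$. -}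

module Defs where

open import Data.Nat using (ℕ; zero; suc)
open import Data.Bool using (Bool; true; false)
open import Data.Bool.Properties using () renaming (_≟_ to _≟ᵇ_)
open import Data.Fin using (Fin; _<_; _<?_; toℕ)
open import Data.Fin.Properties using (any?)
open import Data.Fin.Subset using (Subset; _∈_; _∉_; ⁅_⁆; _∪_; _-_; ∣_∣)
open import Data.Fin.Subset.Properties using (_∈?_)
open import Data.Fin.Permutation using (transpose; _⟨$⟩ˡ_)
open import Data.Vec using (Vec; []; _∷_; tabulate; lookup)
open import Data.Vec.Properties using (≡-dec)
open import Data.List using (List; []; _∷_; _++_; map; filter; length)
open import Data.Product using (Σ; ∃; _×_; _,_)
open import Relation.Nullary using (Dec; yes; no; ¬_)
open import Relation.Nullary.Decidable using (_×-dec_; ¬?)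
open import Relation.Binary.PropositionalEquality using (_≡_; _≢_)

record STS (v : ℕ) : Set₁ where
  field
    IsBlock    : Subset v → Set
    block-size : ∀ B → IsBlock B → ∣ B ∣ ≡ 3
    covers     : ∀ x y → x ≢ y → Σ (Subset v) λ B → IsBlock B × x ∈ B × y ∈ B
    unique     : ∀ x y → x ≢ y → ∀ B B′ → IsBlock B → x ∈ B → y ∈ B →
                   IsBlock B′ → x ∈ B′ → y ∈ B′ → B ≡ B′

-- Edge of Welter's game Γ_{v,3}: (P , (P ∖ {p}) ∪ {q}) with q < p, p ∈ P, q ∉ P.
Edge : ∀ {v} → Subset v → Subset v → Set
Edge {v} P P′ = Σ (Fin v) λ p → Σ (Fin v) λ q →
  q < p × p ∈ P × q ∉ P × P′ ≡ (P - p) ∪ ⁅ q ⁆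

subset-≟ : ∀ {v} (P Q : Subset v) → Dec (P ≡ Q)
subset-≟ = ≡-dec _≟ᵇ_

Edge? : ∀ {v} (P P′ : Subset v) → Dec (Edge P P′)
Edge? P P′ = any? λ p → any? λ q →
  (q <? p) ×-dec (p ∈? P) ×-dec ¬? (q ∈? P) ×-dec subset-≟ P′ ((P - p) ∪ ⁅ q ⁆)

allSubsets : ∀ v → List (Subset v)
allSubsets zero    = [] ∷ []
allSubsets (suc v) = map (true ∷_) (allSubsets v) ++ map (false ∷_) (allSubsets v)

-- Vertices of Γ_{v,3} are the 3-subsets.  Q ∈ N⁻(B) ∩ N⁻(C):
InBoth : ∀ {v} → Subset v → Subset v → Subset v → Set
InBoth B C Q = ∣ Q ∣ ≡ 3 × Edge Q B × Edge Q C

InBoth? : ∀ {v} (B C Q : Subset v) → Dec (InBoth B C Q)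
InBoth? B C Q = (∣ Q ∣ Data.Nat.≟ 3) ×-dec Edge? Q B ×-dec Edge? Q C

I : ∀ {v} → Subset v → Subset v → ℕ
I {v} B C = length (filter (InBoth? B C) (allSubsets v))

[_] : ∀ {p} {P : Set p} → Dec P → ℕ
[ yes _ ] = 1
[ no  _ ] = 0

⁅_,_,_⁆ : ∀ {v} → Fin v → Fin v → Fin v → Subset v
⁅ x , y , z ⁆ = ⁅ x ⁆ ∪ ⁅ y ⁆ ∪ ⁅ z ⁆

-- Image B^σ of B under the transposition (i j):  B^σ = {σ(b) : b ∈ B},
-- i.e. x ∈ B^σ iff σ⁻¹(x) ∈ B.
_^⟨_⟩⟨_⟩ : ∀ {v} → Subset v → Fin v → Fin v → Subset v
B ^⟨ i ⟩⟨ j ⟩ = tabulate λ x → lookup B (transpose i j ⟨$⟩ˡ x)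

module Submission where

-- Let B = {x,b,b′} and C = {x,c,c′} be two 3-sets meeting exactly in
-- x (five distinct points).  If Q → B and Q → C are moves, undoing them gives
-- Q = (B ∖ {q}) ∪ {p} = (C ∖ {q′}) ∪ {p′}; comparing memberships shows that
-- q ≠ x, q′ ≠ x, and that removing b and c forces p = c′, p′ = b′, i.e.
-- Q = {x,b′,c′} with b < c′ and c < b′ (removal-shape).  Hence the common
-- in-neighbours are among the four candidates {x, b or b′, c or c′}, and
-- {x,b,c} is one exactly when b′ < c and c′ < b.  Counting these candidates
-- gives the closed formula I(B,C) = cross-count b b′ c c′ (I-five-points).
-- For blocks of an STS this yields the three parts: (1) a common
-- in-neighbour makes B, C meet, and distinct blocks meet in one point;
-- (2) is the formula under the given order constraints; (3) an adjacent
-- transposition (i i+1) preserves the order of every b-c pair other than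
-- {i, i+1}, and cross-count only depends on these orders.
--
-- Sets are Boolean vectors, so set identities are proved pointwise on
-- membership bits; counts are sums of Iverson brackets over allSubsets.

open import Defs
open import Data.Nat using (ℕ; suc; _+_)
open import Data.Fin using (Fin; toℕ; _<_; _<?_)
open import Data.Fin.Subset using (Subset; _∩_; ∣_∣)
open import Data.Product using (Σ; _×_; _,_)
open import Data.Sum using (_⊎_)
open import Relation.Binary.PropositionalEquality using (_≡_; _≢_)

open import Data.Bool using (Bool; true; false; _∧_; _∨_; not) renaming (_≟_ to _≟ᵇ_)
open import Data.Bool.Properties using (∧-zeroʳ; ∧-identityʳ; ∨-zeroʳ; ∨-identityʳ)
open import Data.Empty using (⊥; ⊥-elim)
open import Data.Fin using (zero; suc; _≟_)
open import Data.Fin.Permutation.Components using (transpose-inverse) renaming (transpose to transposeᶠ)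
open import Data.Fin.Properties using (toℕ-injective; any?)
open import Data.Fin.Subset using (_∪_; _-_; _∈_; _∉_) renaming (⁅_⁆ to ｛_｝; ⊥ to ∅)
open import Data.Fin.Subset.Properties using (∣⁅x⁆∣≡1; p─⊥≡p; ∪-assoc; ∪-comm)
open import Data.List using (List; []; _∷_; _++_; map; filter; length)
open import Data.List.Membership.Propositional using () renaming (_∈_ to _∈ₗ_)
open import Data.List.Relation.Unary.All using (All; []; _∷_)
open import Data.List.Relation.Unary.AllPairs using ([]; _∷_)
open import Data.List.Relation.Unary.Any using (here; there)
open import Data.List.Relation.Unary.Unique.Propositional using (Unique)
open import Data.Nat using (zero; _*_; _≤_; s≤s; z≤n; s≤s⁻¹) renaming (_<_ to _<ℕ_)
open import Data.Nat.Properties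
  using (+-assoc; +-identityʳ; ≤-trans; ≤-reflexive; n≤1+n; n<1+n; ≤∧≢⇒<; <-trans; <-asym; <-irrefl; suc-injective)
open import Data.Nat.Tactic.RingSolver using (solve-∀)
open import Data.Product using (proj₁; proj₂)
open import Data.Sum using (inj₁; inj₂; [_,_]′)
open import Data.Vec using ([]; _∷_; lookup)
open import Data.Vec.Properties
  using (lookup∘tabulate; lookup-zipWith; tabulate∘lookup; tabulate-cong; []=⇒lookup; lookup⇒[]=; ∷-injective)
open import Function using (id)
open import Level using (0ℓ)
open import Relation.Binary.PropositionalEquality
  using (refl; sym; ≢-sym; trans; cong; cong₂; subst; subst₂; module ≡-Reasoning)
open import Relation.Nullary using (Dec; yes; no; ¬_; does)
open import Relation.Nullary.Decidable using (dec-true; dec-false; _×-dec_; ¬?)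
open import Relation.Unary using (Pred; Decidable)

∧-true : ∀ {a b : Bool} → (a ∧ b) ≡ true → a ≡ true × b ≡ true
∧-true {true} {true} _ = refl , refl

not-true : ∀ {a : Bool} → not a ≡ true → a ≡ false
not-true {false} _ = refl

does-iff : ∀ {P Q : Set} → (P → Q) → (Q → P) → (d : Dec P) (e : Dec Q) → does d ≡ does e
does-iff f g (yes p) (yes q) = refl
does-iff f g (yes p) (no ¬q) = ⊥-elim (¬q (f p))
does-iff f g (no ¬p) (yes q) = ⊥-elim (¬p (g q))
does-iff f g (no ¬p) (no ¬q) = refl

eqb : ∀ {v} → Fin v → Fin v → Bool
eqb a z = does (a ≟ z)

mem : ∀ {v} → Subset v → Fin v → Bool
mem S z = lookup S z

eqb-refl : ∀ {v} (a : Fin v) → eqb a a ≡ true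
eqb-refl a = dec-true (a ≟ a) refl

eqb-≢ : ∀ {v} {a b : Fin v} → a ≢ b → eqb a b ≡ false
eqb-≢ {a = a} {b} a≢b = dec-false (a ≟ b) a≢b

eqb-false : ∀ {v} {a b : Fin v} → eqb a b ≡ false → a ≢ b
eqb-false {a = a} e refl with trans (sym (eqb-refl a)) e
... | ()

eqb-true : ∀ {v} {a b : Fin v} → eqb a b ≡ true → a ≡ b
eqb-true {a = a} {b} e with a ≟ b
... | yes a≡b = a≡b

subset-ext : ∀ {v} {S T : Subset v} → (∀ z → mem S z ≡ mem T z) → S ≡ T
subset-ext {S = S} {T} h = trans (sym (tabulate∘lookup S)) (trans (tabulate-cong h) (tabulate∘lookup T))

∈⇒mem : ∀ {v} {S : Subset v} {z} → z ∈ S → mem S z ≡ true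
∈⇒mem = []=⇒lookup

mem⇒∈ : ∀ {v} {S : Subset v} {z} → mem S z ≡ true → z ∈ S
mem⇒∈ {S = S} {z} = lookup⇒[]= z S

∉⇒mem : ∀ {v} {S : Subset v} {z} → z ∉ S → mem S z ≡ false
∉⇒mem {S = S} {z} z∉S with lookup S z in eq
... | true  = ⊥-elim (z∉S (mem⇒∈ eq))
... | false = refl

mem⇒∉ : ∀ {v} {S : Subset v} {z} → mem S z ≡ false → z ∉ S
mem⇒∉ m z∈S with trans (sym (∈⇒mem z∈S)) m
... | ()

separated : ∀ {v} {S T : Subset v} z → mem S z ≡ true → mem T z ≡ false → S ≢ T
separated z z∈S z∉T refl with trans (sym z∈S) z∉T
... | ()

mem-⊥ : ∀ {v} (z : Fin v) → mem ∅ z ≡ false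
mem-⊥ zero    = refl
mem-⊥ (suc z) = mem-⊥ z

mem-∪ : ∀ {v} (S T : Subset v) z → mem (S ∪ T) z ≡ (mem S z ∨ mem T z)
mem-∪ S T z = lookup-zipWith _∨_ z S T

mem-∩ : ∀ {v} (S T : Subset v) z → mem (S ∩ T) z ≡ (mem S z ∧ mem T z)
mem-∩ S T z = lookup-zipWith _∧_ z S T

mem-⁅⁆ : ∀ {v} (a z : Fin v) → mem ｛ a ｝ z ≡ eqb a z
mem-⁅⁆ zero    zero    = refl
mem-⁅⁆ zero    (suc z) = mem-⊥ z
mem-⁅⁆ (suc a) zero    = refl
mem-⁅⁆ (suc a) (suc z) = mem-⁅⁆ a z

mem-minus : ∀ {v} (S : Subset v) a z → mem (S - a) z ≡ (mem S z ∧ not (eqb a z))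
mem-minus (s ∷ S) zero    zero    = sym (∧-zeroʳ s)
mem-minus (s ∷ S) zero    (suc z) = trans (cong (λ T → mem T z) (p─⊥≡p S)) (sym (∧-identityʳ (mem S z)))
mem-minus (s ∷ S) (suc a) zero    = sym (∧-identityʳ s)
mem-minus (s ∷ S) (suc a) (suc z) = mem-minus S a z

mem-minus-true : ∀ {v} (S : Subset v) a z → mem (S - a) z ≡ true → mem S z ≡ true × a ≢ z
mem-minus-true S a z m with ∧-true (trans (sym (mem-minus S a z)) m)
... | inS , a≢z = inS , eqb-false (not-true a≢z)

mem-triple : ∀ {v} (a b c z : Fin v) → mem ⁅ a , b , c ⁆ z ≡ (eqb a z ∨ eqb b z ∨ eqb c z)
mem-triple a b c z rewrite mem-∪ ｛ a ｝ (｛ b ｝ ∪ ｛ c ｝) z | mem-∪ ｛ b ｝ ｛ c ｝ z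
  | mem-⁅⁆ a z | mem-⁅⁆ b z | mem-⁅⁆ c z = refl

triple-∋₁ : ∀ {v} (a b c : Fin v) → mem ⁅ a , b , c ⁆ a ≡ true
triple-∋₁ a b c rewrite mem-triple a b c a | eqb-refl a = refl

triple-∋₂ : ∀ {v} (a b c : Fin v) → mem ⁅ a , b , c ⁆ b ≡ true
triple-∋₂ a b c rewrite mem-triple a b c b | eqb-refl b = ∨-zeroʳ (eqb a b)

triple-∋₃ : ∀ {v} (a b c : Fin v) → mem ⁅ a , b , c ⁆ c ≡ true
triple-∋₃ a b c rewrite mem-triple a b c c | eqb-refl c | ∨-zeroʳ (eqb b c) = ∨-zeroʳ (eqb a c)

triple-∌ : ∀ {v} {a b c z : Fin v} → a ≢ z → b ≢ z → c ≢ z → mem ⁅ a , b , c ⁆ z ≡ false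
triple-∌ {a = a} {b} {c} {z} a≢z b≢z c≢z rewrite mem-triple a b c z | eqb-≢ a≢z | eqb-≢ b≢z | eqb-≢ c≢z = refl

triple-cases : ∀ {v} {a b c z : Fin v} → mem ⁅ a , b , c ⁆ z ≡ true → z ≡ a ⊎ z ≡ b ⊎ z ≡ c
triple-cases {a = a} {b} {c} {z} m with a ≟ z | b ≟ z | c ≟ z | trans (sym m) (mem-triple a b c z)
... | yes a≡z | _       | _       | _ = inj₁ (sym a≡z)
... | no _    | yes b≡z | _       | _ = inj₂ (inj₁ (sym b≡z))
... | no _    | no _    | yes c≡z | _ = inj₂ (inj₂ (sym c≡z))
... | no _    | no _    | no _    | ()

triple-swap₁₂ : ∀ {v} (a b c : Fin v) → ⁅ a , b , c ⁆ ≡ ⁅ b , a , c ⁆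
triple-swap₁₂ a b c = begin
  ｛ a ｝ ∪ (｛ b ｝ ∪ ｛ c ｝)  ≡⟨ sym (∪-assoc ｛ a ｝ ｛ b ｝ ｛ c ｝) ⟩
  (｛ a ｝ ∪ ｛ b ｝) ∪ ｛ c ｝  ≡⟨ cong (_∪ ｛ c ｝) (∪-comm ｛ a ｝ ｛ b ｝) ⟩
  (｛ b ｝ ∪ ｛ a ｝) ∪ ｛ c ｝  ≡⟨ ∪-assoc ｛ b ｝ ｛ a ｝ ｛ c ｝ ⟩
  ｛ b ｝ ∪ (｛ a ｝ ∪ ｛ c ｝)  ∎
  where open ≡-Reasoning

triple-swap₂₃ : ∀ {v} (a b c : Fin v) → ⁅ a , b , c ⁆ ≡ ⁅ a , c , b ⁆
triple-swap₂₃ a b c = cong (｛ a ｝ ∪_) (∪-comm ｛ b ｝ ｛ c ｝)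

bool-ext : ∀ {a b : Bool} → (a ≡ true → b ≡ true) → (b ≡ true → a ≡ true) → a ≡ b
bool-ext {true}  {b}     f g = sym (f refl)
bool-ext {false} {true}  f g = g refl
bool-ext {false} {false} f g = refl

mem-minus-stays : ∀ {v} (S : Subset v) {a z} → mem S z ≡ true → a ≢ z → mem (S - a) z ≡ true
mem-minus-stays S {a} {z} m a≢z = trans (mem-minus S a z) (cong₂ _∧_ m (cong not (eqb-≢ a≢z)))

card-remove : ∀ {v} (S : Subset v) z → mem S z ≡ true → ∣ S ∣ ≡ suc ∣ S - z ∣
card-remove (true  ∷ S) zero    _ = cong (λ T → suc ∣ T ∣) (sym (p─⊥≡p S))
card-remove (true  ∷ S) (suc z) m = cong suc (card-remove S z m)
card-remove (false ∷ S) (suc z) m = card-remove S z m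

minus-absent : ∀ {v} (S : Subset v) a → mem S a ≡ false → S - a ≡ S
minus-absent S a a∉S = subset-ext λ z → trans (mem-minus S a z) (unchanged z)
  where
  unchanged : ∀ z → (mem S z ∧ not (eqb a z)) ≡ mem S z
  unchanged z with a ≟ z
  ... | yes refl = trans (∧-zeroʳ (mem S a)) (sym a∉S)
  ... | no _     = ∧-identityʳ (mem S z)

card-minus-≤ : ∀ {v} (S : Subset v) a → ∣ S ∣ ≤ suc ∣ S - a ∣
card-minus-≤ S a with mem S a in m
... | true  = ≤-reflexive (card-remove S a m)
... | false = ≤-trans (≤-reflexive (cong ∣_∣ (sym (minus-absent S a m)))) (n≤1+n _)

card-≡0 : ∀ {v} (S : Subset v) → (∀ z → mem S z ≢ true) → ∣ S ∣ ≡ 0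
card-≡0 []          _     = refl
card-≡0 (true  ∷ S) empty = ⊥-elim (empty zero refl)
card-≡0 (false ∷ S) empty = card-≡0 S (λ z → empty (suc z))

card-≡0⁻¹ : ∀ {v} (S : Subset v) → ∣ S ∣ ≡ 0 → ∀ z → mem S z ≢ true
card-≡0⁻¹ (false ∷ S) e zero    ()
card-≡0⁻¹ (false ∷ S) e (suc z) = card-≡0⁻¹ S e z

nonempty : ∀ {v} (S : Subset v) → 0 <ℕ ∣ S ∣ → Σ (Fin v) λ z → mem S z ≡ true
nonempty (true  ∷ S) _   = zero , refl
nonempty (false ∷ S) pos with nonempty S pos
... | z , m = suc z , m

card-≤2 : ∀ {v} (S : Subset v) {a c : Fin v} → (∀ {z} → mem S z ≡ true → z ≡ a ⊎ z ≡ c) → ∣ S ∣ ≤ 2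
card-≤2 S {a} {c} only =
  ≤-trans (card-minus-≤ S a) (s≤s (≤-trans (card-minus-≤ (S - a) c) (s≤s (≤-reflexive (card-≡0 (S - a - c) gone)))))
  where
  gone : ∀ z → mem (S - a - c) z ≢ true
  gone z m with mem-minus-true (S - a) c z m
  ... | m′ , c≢z with mem-minus-true S a z m′
  ... | m″ , a≢z with only m″
  ... | inj₁ z≡a = a≢z (sym z≡a)
  ... | inj₂ z≡c = c≢z (sym z≡c)

card-triple : ∀ {v} (a b c : Fin v) → a ≢ b → a ≢ c → b ≢ c → ∣ ⁅ a , b , c ⁆ ∣ ≡ 3
card-triple a b c a≢b a≢c b≢c = begin
  ∣ S ∣                      ≡⟨ card-remove S a (triple-∋₁ a b c) ⟩
  suc ∣ S - a ∣              ≡⟨ cong suc (card-remove (S - a) b b∈S-a) ⟩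
  suc (suc ∣ S - a - b ∣)    ≡⟨ cong (λ n → suc (suc n)) (card-remove (S - a - b) c c∈S-a-b) ⟩
  suc (suc (suc ∣ S - a - b - c ∣)) ≡⟨ cong (λ n → suc (suc (suc n))) (card-≡0 (S - a - b - c) gone) ⟩
  3                          ∎
  where
  open ≡-Reasoning
  S = ⁅ a , b , c ⁆
  b∈S-a : mem (S - a) b ≡ true
  b∈S-a = mem-minus-stays S (triple-∋₂ a b c) a≢b
  c∈S-a-b : mem (S - a - b) c ≡ true
  c∈S-a-b = mem-minus-stays (S - a) (mem-minus-stays S (triple-∋₃ a b c) a≢c) b≢c
  gone : ∀ z → mem (S - a - b - c) z ≢ true
  gone z m with mem-minus-true (S - a - b) c z m
  ... | m₁ , c≢z with mem-minus-true (S - a) b z m₁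
  ... | m₂ , b≢z with mem-minus-true S a z m₂
  ... | m₃ , a≢z with triple-cases m₃
  ... | inj₁ z≡a        = a≢z (sym z≡a)
  ... | inj₂ (inj₁ z≡b) = b≢z (sym z≡b)
  ... | inj₂ (inj₂ z≡c) = c≢z (sym z≡c)

triple-distinct : ∀ {v} (a b c : Fin v) → ∣ ⁅ a , b , c ⁆ ∣ ≡ 3 → a ≢ b × a ≢ c × b ≢ c
triple-distinct a b c three =
    (λ { refl → small {a} {c} λ m → [ inj₁ , [ inj₁ , inj₂ ]′ ]′ (triple-cases m) })
  , (λ { refl → small {a} {b} λ m → [ inj₁ , [ inj₂ , inj₁ ]′ ]′ (triple-cases m) })
  , (λ { refl → small {a} {b} λ m → [ inj₁ , [ inj₂ , inj₂ ]′ ]′ (triple-cases m) })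
  where
  small : ∀ {x y} → (∀ {z} → mem ⁅ a , b , c ⁆ z ≡ true → z ≡ x ⊎ z ≡ y) → ⊥
  small only with ≤-trans (≤-reflexive (sym three)) (card-≤2 ⁅ a , b , c ⁆ only)
  ... | s≤s (s≤s ())

pick : ∀ {v} (S : Subset v) {n} → ∣ S ∣ ≡ suc n → Σ (Fin v) λ z → mem S z ≡ true × ∣ S - z ∣ ≡ n
pick S e with nonempty S (subst (0 <ℕ_) (sym e) (s≤s z≤n))
... | z , m = z , m , suc-injective (trans (sym (card-remove S z m)) e)

triple-decompose : ∀ {v} (S : Subset v) x → ∣ S ∣ ≡ 3 → mem S x ≡ true →
  Σ (Fin v) λ b₁ → Σ (Fin v) λ b₂ → x ≢ b₁ × x ≢ b₂ × b₁ ≢ b₂ × S ≡ ⁅ x , b₁ , b₂ ⁆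
triple-decompose S x three x∈S
  with pick (S - x) (suc-injective (trans (sym (card-remove S x x∈S)) three))
... | b₁ , b₁∈S-x , two
  with pick (S - x - b₁) two
... | b₂ , b₂∈S-x-b₁ , none =
  b₁ , b₂ , x≢b₁ , x≢b₂ , b₁≢b₂ , subset-ext λ z → bool-ext (S⊆T z) (T⊆S z)
  where
  b₁-facts : mem S b₁ ≡ true × x ≢ b₁
  b₁-facts = mem-minus-true S x b₁ b₁∈S-x
  b₂-facts′ : mem (S - x) b₂ ≡ true × b₁ ≢ b₂
  b₂-facts′ = mem-minus-true (S - x) b₁ b₂ b₂∈S-x-b₁
  b₂-facts : mem S b₂ ≡ true × x ≢ b₂
  b₂-facts = mem-minus-true S x b₂ (proj₁ b₂-facts′)
  x≢b₁ : x ≢ b₁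
  x≢b₁ = proj₂ b₁-facts
  x≢b₂ : x ≢ b₂
  x≢b₂ = proj₂ b₂-facts
  b₁≢b₂ : b₁ ≢ b₂
  b₁≢b₂ = proj₂ b₂-facts′
  S⊆T : ∀ z → mem S z ≡ true → mem ⁅ x , b₁ , b₂ ⁆ z ≡ true
  S⊆T z m with x ≟ z | b₁ ≟ z | b₂ ≟ z
  ... | yes refl | _        | _        = triple-∋₁ x b₁ b₂
  ... | no _     | yes refl | _        = triple-∋₂ x b₁ b₂
  ... | no _     | no _     | yes refl = triple-∋₃ x b₁ b₂
  ... | no x≢z   | no b₁≢z  | no b₂≢z  = ⊥-elim (card-≡0⁻¹ (S - x - b₁ - b₂) none z
          (mem-minus-stays (S - x - b₁) (mem-minus-stays (S - x) (mem-minus-stays S m x≢z) b₁≢z) b₂≢z))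
  T⊆S : ∀ z → mem ⁅ x , b₁ , b₂ ⁆ z ≡ true → mem S z ≡ true
  T⊆S z m with triple-cases {a = x} {b₁} {b₂} m
  ... | inj₁ refl        = x∈S
  ... | inj₂ (inj₁ refl) = proj₁ b₁-facts
  ... | inj₂ (inj₂ refl) = proj₁ b₂-facts

[]-yes : ∀ {P : Set} → P → (d : Dec P) → [ d ] ≡ 1
[]-yes p (yes _) = refl
[]-yes p (no ¬p) = ⊥-elim (¬p p)

[]-no : ∀ {P : Set} → ¬ P → (d : Dec P) → [ d ] ≡ 0
[]-no ¬p (yes p) = ⊥-elim (¬p p)
[]-no ¬p (no _)  = refl

[]-iff : ∀ {P P′ : Set} → (P → P′) → (P′ → P) → (d : Dec P) (d′ : Dec P′) → [ d ] ≡ [ d′ ]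
[]-iff f g (yes p) d′ = sym ([]-yes (f p) d′)
[]-iff f g (no ¬p) d′ = sym ([]-no (λ p′ → ¬p (g p′)) d′)

[]-× : ∀ {P Q : Set} (d : Dec P) (e : Dec Q) → [ d ×-dec e ] ≡ [ d ] * [ e ]
[]-× (yes _) (yes _) = refl
[]-× (yes _) (no _)  = refl
[]-× (no _)  _       = refl

[]-split : ∀ {P E : Set} (d : Dec P) (e : Dec E) → [ d ] ≡ [ d ×-dec e ] + [ d ×-dec ¬? e ]
[]-split (yes _) (yes _) = refl
[]-split (yes _) (no _)  = refl
[]-split (no _)  _       = refl

Σl : ∀ {A : Set} → (A → ℕ) → List A → ℕ
Σl f []       = 0
Σl f (x ∷ xs) = f x + Σl f xs

Σl-congᴬ : ∀ {A : Set} {f g : A → ℕ} {xs} → All (λ x → f x ≡ g x) xs → Σl f xs ≡ Σl g xs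
Σl-congᴬ []         = refl
Σl-congᴬ (e ∷ es) = cong₂ _+_ e (Σl-congᴬ es)

Σl-cong : ∀ {A : Set} {f g : A → ℕ} → (∀ x → f x ≡ g x) → ∀ xs → Σl f xs ≡ Σl g xs
Σl-cong h []       = refl
Σl-cong h (x ∷ xs) = cong₂ _+_ (h x) (Σl-cong h xs)

Σl-0 : ∀ {A : Set} {f : A → ℕ} → (∀ x → f x ≡ 0) → ∀ xs → Σl f xs ≡ 0
Σl-0 h xs = trans (Σl-cong h xs) (zeros xs)
  where zeros : ∀ xs → Σl (λ _ → 0) xs ≡ 0
        zeros []       = refl
        zeros (_ ∷ xs) = zeros xs

Σl-+ : ∀ {A : Set} (f g : A → ℕ) xs → Σl (λ x → f x + g x) xs ≡ Σl f xs + Σl g xs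
Σl-+ f g []       = refl
Σl-+ f g (x ∷ xs) = trans (cong (f x + g x +_) (Σl-+ f g xs)) (+-interchange (f x) (g x) (Σl f xs) (Σl g xs))
  where
  +-interchange : ∀ a b c d → (a + b) + (c + d) ≡ (a + c) + (b + d)
  +-interchange = solve-∀

Σl-++ : ∀ {A : Set} (f : A → ℕ) xs ys → Σl f (xs ++ ys) ≡ Σl f xs + Σl f ys
Σl-++ f []       ys = refl
Σl-++ f (x ∷ xs) ys = trans (cong (f x +_) (Σl-++ f xs ys)) (sym (+-assoc (f x) _ _))

Σl-map : ∀ {A B : Set} (f : B → ℕ) (g : A → B) xs → Σl f (map g xs) ≡ Σl (λ x → f (g x)) xs
Σl-map f g []       = refl
Σl-map f g (x ∷ xs) = cong (f (g x) +_) (Σl-map f g xs)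

length-filter : ∀ {A : Set} {P : Pred A 0ℓ} (P? : Decidable P) xs → length (filter P? xs) ≡ Σl (λ x → [ P? x ]) xs
length-filter P? []       = refl
length-filter P? (x ∷ xs) with P? x
... | yes _ = cong suc (length-filter P? xs)
... | no _  = length-filter P? xs

filter-witness : ∀ {A : Set} {P : Pred A 0ℓ} (P? : Decidable P) xs → length (filter P? xs) ≢ 0 → Σ A P
filter-witness P? []       ne = ⊥-elim (ne refl)
filter-witness P? (x ∷ xs) ne with P? x
... | yes p = x , p
... | no _  = filter-witness P? xs ne

count : ∀ {v} {P : Pred (Subset v) 0ℓ} → Decidable P → ℕ
count {v} P? = Σl (λ Q → [ P? Q ]) (allSubsets v)

count-≡ : ∀ v (R : Subset v) → count (λ Q → subset-≟ Q R) ≡ 1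
count-≡ zero    []      = refl
count-≡ (suc v) (b ∷ R) = begin
  Σl f (map (true ∷_) A ++ map (false ∷_) A)                           ≡⟨ Σl-++ f (map (true ∷_) A) (map (false ∷_) A) ⟩
  Σl f (map (true ∷_) A) + Σl f (map (false ∷_) A)                    ≡⟨ cong₂ _+_ (Σl-map f _ A) (Σl-map f _ A) ⟩
  Σl (λ Q → f (true ∷ Q)) A + Σl (λ Q → f (false ∷ Q)) A              ≡⟨ by-head b ⟩
  1                                                                   ∎
  where
  open ≡-Reasoning
  A : List (Subset v)
  A = allSubsets v
  f : Subset (suc v) → ℕ
  f Q = [ subset-≟ Q (b ∷ R) ]
  same-head : ∀ c Q → [ subset-≟ (c ∷ Q) (c ∷ R) ] ≡ [ subset-≟ Q R ]
  same-head c Q = []-iff (λ e → proj₂ (∷-injective e)) (cong (c ∷_)) (subset-≟ (c ∷ Q) (c ∷ R)) (subset-≟ Q R)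
  other-head : ∀ {c d} → c ≢ d → ∀ Q → [ subset-≟ (c ∷ Q) (d ∷ R) ] ≡ 0
  other-head c≢d Q = []-no (λ e → c≢d (proj₁ (∷-injective e))) (subset-≟ _ _)
  by-head : ∀ b → Σl (λ Q → [ subset-≟ (true ∷ Q) (b ∷ R) ]) A + Σl (λ Q → [ subset-≟ (false ∷ Q) (b ∷ R) ]) A ≡ 1
  by-head true  = cong₂ _+_ (trans (Σl-cong (same-head true) A) (count-≡ v R)) (Σl-0 (other-head {false} {true} (λ ())) A)
  by-head false = cong₂ _+_ (Σl-0 (other-head {true} {false} (λ ())) A) (trans (Σl-cong (same-head false) A) (count-≡ v R))

count-at : ∀ {v} {P : Pred (Subset v) 0ℓ} (P? : Decidable P) (R : Subset v) →
  count (λ Q → P? Q ×-dec subset-≟ Q R) ≡ [ P? R ]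
count-at {v} P? R with P? R
... | yes p = trans (Σl-cong (λ Q → []-iff proj₂ (λ { refl → p , refl }) (P? Q ×-dec subset-≟ Q R) (subset-≟ Q R)) (allSubsets v))
                    (count-≡ v R)
... | no ¬p = Σl-0 (λ Q → []-no (λ { (p , refl) → ¬p p }) (P? Q ×-dec subset-≟ Q R)) (allSubsets v)

count-candidates : ∀ {v} {P : Pred (Subset v) 0ℓ} (P? : Decidable P) (Rs : List (Subset v)) →
  Unique Rs → (∀ {Q} → P Q → Q ∈ₗ Rs) → count P? ≡ Σl (λ R → [ P? R ]) Rs
count-candidates {v} P? [] _ cand = Σl-0 (λ Q → []-no (λ p → no-candidate (cand p)) (P? Q)) (allSubsets v)
  where no-candidate : ∀ {Q} → ¬ (Q ∈ₗ [])
        no-candidate ()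
count-candidates {v} {P} P? (R ∷ Rs) (R∉Rs ∷ unique) cand = begin
  count P?                                                   ≡⟨ Σl-cong (λ Q → []-split (P? Q) (subset-≟ Q R)) A ⟩
  Σl (λ Q → [ P? Q ×-dec subset-≟ Q R ] + [ P≢R? Q ]) A      ≡⟨ Σl-+ _ _ A ⟩
  count (λ Q → P? Q ×-dec subset-≟ Q R) + count P≢R?          ≡⟨ cong₂ _+_ (count-at P? R) (count-candidates P≢R? Rs unique cand′) ⟩
  [ P? R ] + Σl (λ R′ → [ P≢R? R′ ]) Rs                        ≡⟨ cong ([ P? R ] +_) (Σl-congᴬ (drop-≢ R∉Rs)) ⟩
  [ P? R ] + Σl (λ R′ → [ P? R′ ]) Rs                          ∎
  where
  open ≡-Reasoning
  A : List (Subset v)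
  A = allSubsets v
  P≢R? : Decidable (λ Q → P Q × ¬ (Q ≡ R))
  P≢R? Q = P? Q ×-dec ¬? (subset-≟ Q R)
  cand′ : ∀ {Q} → P Q × ¬ (Q ≡ R) → Q ∈ₗ Rs
  cand′ (p , Q≢R) with cand p
  ... | here Q≡R  = ⊥-elim (Q≢R Q≡R)
  ... | there Q∈Rs = Q∈Rs
  drop-≢ : ∀ {Rs′} → All (λ R′ → ¬ (R ≡ R′)) Rs′ → All (λ R′ → [ P≢R? R′ ] ≡ [ P? R′ ]) Rs′
  drop-≢ []           = []
  drop-≢ (R≢R′ ∷ rest) = []-iff proj₁ (λ p → p , λ e → R≢R′ (sym e)) (P≢R? _) (P? _) ∷ drop-≢ rest

Move : ∀ {v} → Subset v → Subset v → Fin v → Fin v → Set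
Move Q B p q = q < p × p ∈ Q × q ∉ Q × B ≡ (Q - p) ∪ ｛ q ｝

move-inverse : ∀ {v} {Q B : Subset v} {p q} → Move Q B p q →
  ∀ z → mem Q z ≡ ((mem B z ∧ not (eqb q z)) ∨ eqb p z)
move-inverse {Q = Q} {p = p} {q} (q<p , p∈Q , q∉Q , refl) z
  rewrite mem-∪ (Q - p) ｛ q ｝ z | mem-minus Q p z | mem-⁅⁆ q z with p ≟ z | q ≟ z
... | yes refl | yes refl = ⊥-elim (<-irrefl refl q<p)
... | yes refl | no _     rewrite ∈⇒mem p∈Q = refl
... | no _     | yes refl rewrite ∉⇒mem q∉Q = refl
... | no _     | no _     rewrite ∧-identityʳ (mem Q z) | ∨-identityʳ (mem Q z)
                                | ∧-identityʳ (mem Q z) | ∨-identityʳ (mem Q z) = refl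

move-fresh : ∀ {v} {Q B : Subset v} {p q} → Move Q B p q → q ∉ Q
move-fresh (_ , _ , q∉Q , _) = q∉Q

move-enters : ∀ {v} {Q B : Subset v} {p q} → Move Q B p q → mem B q ≡ true
move-enters {Q = Q} {p = p} {q} (_ , _ , _ , refl)
  rewrite mem-∪ (Q - p) ｛ q ｝ q | mem-⁅⁆ q q | eqb-refl q = ∨-zeroʳ _

move-keeps : ∀ {v} {Q B : Subset v} {p q y} → Move Q B p q → mem Q y ≡ true → p ≢ y → mem B y ≡ true
move-keeps {Q = Q} {p = p} {q} {y} (_ , _ , _ , refl) y∈Q p≢y
  rewrite mem-∪ (Q - p) ｛ q ｝ y | mem-minus-stays Q y∈Q p≢y = refl

move-along : ∀ {v} {Q B B′ : Subset v} {p q} → B ≡ B′ → Move Q B p q → Move Q B′ p q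
move-along refl m = m

Meet : ∀ {v} → Subset v → Subset v → Set
Meet {v} B C = Σ (Fin v) λ y → mem B y ≡ true × mem C y ≡ true

meet? : ∀ {v} (B C : Subset v) → Dec (Meet B C)
meet? B C = any? λ y → (mem B y ≟ᵇ true) ×-dec (mem C y ≟ᵇ true)

-- Two sets with a common in-neighbour Q meet: Q has three points and only
-- two of them can leave.
common-point : ∀ {v} {B C Q : Subset v} → InBoth B C Q → Meet B C
common-point {Q = Q} (three , (p , q , toB) , (p′ , q′ , toC)) with nonempty (Q - p - p′) positive
  where
  positive : 0 <ℕ ∣ Q - p - p′ ∣
  positive = s≤s⁻¹ (s≤s⁻¹ (≤-trans (≤-reflexive (sym three))
               (≤-trans (card-minus-≤ Q p) (s≤s (card-minus-≤ (Q - p) p′)))))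
... | y , y∈Q-p-p′ with mem-minus-true (Q - p) p′ y y∈Q-p-p′
... | y∈Q-p , p′≢y with mem-minus-true Q p y y∈Q-p
... | y∈Q , p≢y = y , move-keeps toB y∈Q p≢y , move-keeps toC y∈Q p′≢y

I≢0⇒common-point : ∀ {v} (B C : Subset v) → I B C ≢ 0 → Meet B C
I≢0⇒common-point {v} B C I≢0 = common-point (proj₂ (filter-witness (InBoth? B C) (allSubsets v) I≢0))

-- Five distinct points: the configuration of two blocks {x,b,b′} and
-- {x,c,c′} meeting exactly in x.
record FiveDistinct {v} (x b b′ c c′ : Fin v) : Set where
  field
    x≢b : x ≢ b
    x≢b′ : x ≢ b′
    x≢c : x ≢ c
    x≢c′ : x ≢ c′
    b≢b′ : b ≢ b′
    b≢c : b ≢ c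
    b≢c′ : b ≢ c′
    b′≢c : b′ ≢ c
    b′≢c′ : b′ ≢ c′
    c≢c′ : c ≢ c′

swap-b : ∀ {v} {x b b′ c c′ : Fin v} → FiveDistinct x b b′ c c′ → FiveDistinct x b′ b c c′
swap-b d = record { x≢b = x≢b′ ; x≢b′ = x≢b ; x≢c = x≢c ; x≢c′ = x≢c′ ; b≢b′ = λ e → b≢b′ (sym e)
  ; b≢c = b′≢c ; b≢c′ = b′≢c′ ; b′≢c = b≢c ; b′≢c′ = b≢c′ ; c≢c′ = c≢c′ }
  where open FiveDistinct d

swap-c : ∀ {v} {x b b′ c c′ : Fin v} → FiveDistinct x b b′ c c′ → FiveDistinct x b b′ c′ c
swap-c d = record { x≢b = x≢b ; x≢b′ = x≢b′ ; x≢c = x≢c′ ; x≢c′ = x≢c ; b≢b′ = b≢b′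
  ; b≢c = b≢c′ ; b≢c′ = b≢c ; b′≢c = b′≢c′ ; b′≢c′ = b′≢c ; c≢c′ = λ e → c≢c′ (sym e) }
  where open FiveDistinct d

swap-blocks : ∀ {v} {x b b′ c c′ : Fin v} → FiveDistinct x b b′ c c′ → FiveDistinct x c c′ b b′
swap-blocks d = record { x≢b = x≢c ; x≢b′ = x≢c′ ; x≢c = x≢b ; x≢c′ = x≢b′ ; b≢b′ = c≢c′
  ; b≢c = λ e → b≢c (sym e) ; b≢c′ = λ e → b′≢c (sym e) ; b′≢c = λ e → b≢c′ (sym e)
  ; b′≢c′ = λ e → b′≢c′ (sym e) ; c≢c′ = b≢b′ }
  where open FiveDistinct d

map-five : ∀ {v} {x b b′ c c′ : Fin v} {f : Fin v → Fin v} → (∀ {a a′} → f a ≡ f a′ → a ≡ a′) →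
  FiveDistinct x b b′ c c′ → FiveDistinct (f x) (f b) (f b′) (f c) (f c′)
map-five {v} {f = f} f-inj d = record { x≢b = keep x≢b ; x≢b′ = keep x≢b′ ; x≢c = keep x≢c ; x≢c′ = keep x≢c′
  ; b≢b′ = keep b≢b′ ; b≢c = keep b≢c ; b≢c′ = keep b≢c′ ; b′≢c = keep b′≢c ; b′≢c′ = keep b′≢c′ ; c≢c′ = keep c≢c′ }
  where
  open FiveDistinct d
  keep : ∀ {a a′ : Fin v} → a ≢ a′ → f a ≢ f a′
  keep a≢a′ e = a≢a′ (f-inj e)

-- A Boolean expression in the five bits [x = z], [b = z], [b′ = z], [c = z], [c′ = z].
Bits⇒Bool : Set
Bits⇒Bool = Bool → Bool → Bool → Bool → Bool → Bool

module _ {v} {x b b′ c c′ : Fin v} (d : FiveDistinct x b b′ c c′) where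
  open FiveDistinct d

  -- Two such expressions agree at every point z once they agree at x, b,
  -- b′, c, c′ and at a point different from all five.
  five-point-ext : (F G : Bits⇒Bool) →
    F true false false false false ≡ G true false false false false →
    F false true false false false ≡ G false true false false false →
    F false false true false false ≡ G false false true false false →
    F false false false true false ≡ G false false false true false →
    F false false false false true ≡ G false false false false true →
    F false false false false false ≡ G false false false false false →
    ∀ z → F (eqb x z) (eqb b z) (eqb b′ z) (eqb c z) (eqb c′ z) ≡ G (eqb x z) (eqb b z) (eqb b′ z) (eqb c z) (eqb c′ z)
  five-point-ext F G at-x at-b at-b′ at-c at-c′ elsewhere z with x ≟ z
  ... | yes refl rewrite eqb-≢ (≢-sym x≢b) | eqb-≢ (≢-sym x≢b′) | eqb-≢ (≢-sym x≢c) | eqb-≢ (≢-sym x≢c′) = at-x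
  ... | no _ with b ≟ z
  ... | yes refl rewrite eqb-≢ (≢-sym b≢b′) | eqb-≢ (≢-sym b≢c) | eqb-≢ (≢-sym b≢c′) = at-b
  ... | no _ with b′ ≟ z
  ... | yes refl rewrite eqb-≢ (≢-sym b′≢c) | eqb-≢ (≢-sym b′≢c′) = at-b′
  ... | no _ with c ≟ z
  ... | yes refl rewrite eqb-≢ (≢-sym c≢c′) = at-c
  ... | no _ with c′ ≟ z
  ... | yes refl = at-c′
  ... | no _     = elsewhere

-- Undoing a move into B (remove q, add p) and a move into C (remove q′,
-- add p′) leads back to the same set.
record SameUndo {v} (B C : Subset v) (p q p′ q′ : Fin v) : Set where
  field
    same : ∀ z → ((mem B z ∧ not (eqb q z)) ∨ eqb p z) ≡ ((mem C z ∧ not (eqb q′ z)) ∨ eqb p′ z)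

same-undo : ∀ {v} {Q B C : Subset v} {p q p′ q′} → Move Q B p q → Move Q C p′ q′ → SameUndo B C p q p′ q′
same-undo toB toC = record { same = λ z → trans (sym (move-inverse toB z)) (move-inverse toC z) }

undo-sym : ∀ {v} {B C : Subset v} {p q p′ q′} → SameUndo B C p q p′ q′ → SameUndo C B p′ q′ p q
undo-sym H = record { same = λ z → sym (SameUndo.same H z) }

undo-enters : ∀ {v} {B C : Subset v} {p q p′ q′ y} → SameUndo B C p q p′ q′ →
  mem B y ≡ true → q ≢ y → mem C y ≡ false → p′ ≡ y
undo-enters {B = B} {C} {p} {q} {p′} {q′} {y} H y∈B q≢y y∉C = eqb-true (begin
  eqb p′ y                                    ≡⟨⟩
  (false ∧ not (eqb q′ y)) ∨ eqb p′ y          ≡⟨ cong (λ m → (m ∧ not (eqb q′ y)) ∨ eqb p′ y) (sym y∉C) ⟩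
  (mem C y ∧ not (eqb q′ y)) ∨ eqb p′ y        ≡⟨ sym (SameUndo.same H y) ⟩
  (mem B y ∧ not (eqb q y)) ∨ eqb p y          ≡⟨ cong₂ (λ m e → (m ∧ not e) ∨ eqb p y) y∈B (eqb-≢ q≢y) ⟩
  true                                         ∎)
  where open ≡-Reasoning

module _ {v} {x b b′ c c′ : Fin v} (d : FiveDistinct x b b′ c c′) where
  open FiveDistinct d

  private
    B C : Subset v
    B = ⁅ x , b , b′ ⁆
    C = ⁅ x , c , c′ ⁆

  -- The common point x cannot leave: then both b and b′ would have to be
  -- the single point added back on C's side.
  undo-not-x : ∀ {p p′ q′} → ¬ SameUndo B C p x p′ q′
  undo-not-x H = b≢b′ (trans (sym (undo-enters H (triple-∋₂ x b b′) x≢b (triple-∌ x≢b (≢-sym b≢c) (≢-sym b≢c′))))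
                             (undo-enters H (triple-∋₃ x b b′) x≢b′ (triple-∌ x≢b′ (≢-sym b′≢c) (≢-sym b′≢c′))))

  undo-shape : ∀ {p p′} → SameUndo B C p b p′ c → p ≡ c′ × p′ ≡ b′
  undo-shape H =
      undo-enters (undo-sym H) (triple-∋₃ x c c′) c≢c′ (triple-∌ x≢c′ b≢c′ b′≢c′)
    , undo-enters H (triple-∋₃ x b b′) b≢b′ (triple-∌ x≢b′ (≢-sym b′≢c) (≢-sym b′≢c′))

  removal-shape : ∀ {Q p p′} → Move Q B p b → Move Q C p′ c → (b < c′ × c < b′) × Q ≡ ⁅ x , b′ , c′ ⁆
  removal-shape {Q} {p} {p′} toB toC with undo-shape {p} {p′} (same-undo toB toC)
  ... | refl , refl = (proj₁ toB , proj₁ toC) , subset-ext λ z → begin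
    mem Q z                                                       ≡⟨ move-inverse toB z ⟩
    (mem B z ∧ not (eqb b z)) ∨ eqb c′ z                          ≡⟨ cong (λ m → (m ∧ not (eqb b z)) ∨ eqb c′ z) (mem-triple x b b′ z) ⟩
    ((eqb x z ∨ eqb b z ∨ eqb b′ z) ∧ not (eqb b z)) ∨ eqb c′ z   ≡⟨ five-point-ext d
                                                                     (λ X B₁ B₂ C₁ C₂ → ((X ∨ B₁ ∨ B₂) ∧ not B₁) ∨ C₂)
                                                                     (λ X B₁ B₂ C₁ C₂ → X ∨ B₂ ∨ C₂)
                                                                     refl refl refl refl refl refl z ⟩
    eqb x z ∨ eqb b′ z ∨ eqb c′ z                                 ≡⟨ sym (mem-triple x b′ c′ z) ⟩
    mem ⁅ x , b′ , c′ ⁆ z                                         ∎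
    where open ≡-Reasoning

module _ {v} {x b b′ c c′ : Fin v} (d : FiveDistinct x b b′ c c′) where
  open FiveDistinct d

  private
    B C : Subset v
    B = ⁅ x , b , b′ ⁆
    C = ⁅ x , c , c′ ⁆

  candidates : List (Subset v)
  candidates = ⁅ x , b , c ⁆ ∷ ⁅ x , b , c′ ⁆ ∷ ⁅ x , b′ , c ⁆ ∷ ⁅ x , b′ , c′ ⁆ ∷ []

  candidates-unique : Unique candidates
  candidates-unique =
      (separated c (triple-∋₃ x b c) (triple-∌ x≢c b≢c (≢-sym c≢c′))
       ∷ separated b (triple-∋₂ x b c) (triple-∌ x≢b (≢-sym b≢b′) (≢-sym b≢c))
       ∷ separated b (triple-∋₂ x b c) (triple-∌ x≢b (≢-sym b≢b′) (≢-sym b≢c′)) ∷ [])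
    ∷ (separated b (triple-∋₂ x b c′) (triple-∌ x≢b (≢-sym b≢b′) (≢-sym b≢c))
       ∷ separated b (triple-∋₂ x b c′) (triple-∌ x≢b (≢-sym b≢b′) (≢-sym b≢c′)) ∷ [])
    ∷ (separated c (triple-∋₃ x b′ c) (triple-∌ x≢c b′≢c (≢-sym c≢c′)) ∷ [])
    ∷ [] ∷ []

  -- Every common in-neighbour of B and C is a candidate: the leaving points
  -- are not x, and removal-shape determines Q from them.
  in-neighbour-candidates : ∀ {Q} → InBoth B C Q → Q ∈ₗ candidates
  in-neighbour-candidates (_ , (p , q , toB) , (p′ , q′ , toC))
    with triple-cases {a = x} {b} {b′} (move-enters toB) | triple-cases {a = x} {c} {c′} (move-enters toC)
  ... | inj₁ refl        | _                = ⊥-elim (undo-not-x d (same-undo toB toC))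
  ... | inj₂ _           | inj₁ refl        = ⊥-elim (undo-not-x (swap-blocks d) (undo-sym (same-undo toB toC)))
  ... | inj₂ (inj₁ refl) | inj₂ (inj₁ refl) =
    there (there (there (here (proj₂ (removal-shape d toB toC)))))
  ... | inj₂ (inj₁ refl) | inj₂ (inj₂ refl) =
    there (there (here (proj₂ (removal-shape (swap-c d) toB (move-along (triple-swap₂₃ x c c′) toC)))))
  ... | inj₂ (inj₂ refl) | inj₂ (inj₁ refl) =
    there (here (proj₂ (removal-shape (swap-b d) (move-along (triple-swap₂₃ x b b′) toB) toC)))
  ... | inj₂ (inj₂ refl) | inj₂ (inj₂ refl) =
    here (proj₂ (removal-shape (swap-b (swap-c d)) (move-along (triple-swap₂₃ x b b′) toB) (move-along (triple-swap₂₃ x c c′) toC)))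

  -- The candidate {x, b, c} is a common in-neighbour only if b′ < c and c′ < b:
  -- the leaving points must be b′ and c′.
  candidate-necessary : InBoth B C ⁅ x , b , c ⁆ → b′ < c × c′ < b
  candidate-necessary (_ , (p , q , toB) , (p′ , q′ , toC))
    with triple-cases {a = x} {b} {b′} (move-enters toB) | triple-cases {a = x} {c} {c′} (move-enters toC)
  ... | inj₁ refl        | _                = ⊥-elim (move-fresh toB (mem⇒∈ (triple-∋₁ x b c)))
  ... | inj₂ (inj₁ refl) | _                = ⊥-elim (move-fresh toB (mem⇒∈ (triple-∋₂ x b c)))
  ... | inj₂ (inj₂ _)    | inj₁ refl        = ⊥-elim (move-fresh toC (mem⇒∈ (triple-∋₁ x b c)))
  ... | inj₂ (inj₂ _)    | inj₂ (inj₁ refl) = ⊥-elim (move-fresh toC (mem⇒∈ (triple-∋₃ x b c)))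
  ... | inj₂ (inj₂ refl) | inj₂ (inj₂ refl) =
    proj₁ (removal-shape (swap-b (swap-c d)) (move-along (triple-swap₂₃ x b b′) toB) (move-along (triple-swap₂₃ x c c′) toC))

  candidate-sufficient : b′ < c → c′ < b → InBoth B C ⁅ x , b , c ⁆
  candidate-sufficient b′<c c′<b =
      card-triple x b c x≢b x≢c b≢c
    , (c , b′ , b′<c , mem⇒∈ (triple-∋₃ x b c) , mem⇒∉ (triple-∌ x≢b′ b≢b′ (≢-sym b′≢c)) ,
       subset-ext λ z → trans (mem-triple x b b′ z) (trans (five-point-ext d
         (λ X B₁ B₂ C₁ C₂ → X ∨ B₁ ∨ B₂) (λ X B₁ B₂ C₁ C₂ → ((X ∨ B₁ ∨ C₁) ∧ not C₁) ∨ B₂)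
         refl refl refl refl refl refl z) (sym (mem-replace c b′ z))))
    , (b , c′ , c′<b , mem⇒∈ (triple-∋₂ x b c) , mem⇒∉ (triple-∌ x≢c′ b≢c′ c≢c′) ,
       subset-ext λ z → trans (mem-triple x c c′ z) (trans (five-point-ext d
         (λ X B₁ B₂ C₁ C₂ → X ∨ C₁ ∨ C₂) (λ X B₁ B₂ C₁ C₂ → ((X ∨ B₁ ∨ C₁) ∧ not B₁) ∨ C₂)
         refl refl refl refl refl refl z) (sym (mem-replace b c′ z))))
    where
    mem-replace : ∀ r s z → mem ((⁅ x , b , c ⁆ - r) ∪ ｛ s ｝) z ≡ (((eqb x z ∨ eqb b z ∨ eqb c z) ∧ not (eqb r z)) ∨ eqb s z)
    mem-replace r s z rewrite mem-∪ (⁅ x , b , c ⁆ - r) ｛ s ｝ z | mem-minus ⁅ x , b , c ⁆ r z | mem-⁅⁆ s z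
      | mem-triple x b c z = refl

  candidate-count : [ InBoth? B C ⁅ x , b , c ⁆ ] ≡ [ b′ <? c ] * [ c′ <? b ]
  candidate-count = trans
    ([]-iff candidate-necessary (λ (b′<c , c′<b) → candidate-sufficient b′<c c′<b) (InBoth? B C ⁅ x , b , c ⁆) ((b′ <? c) ×-dec (c′ <? b)))
    ([]-× (b′ <? c) (c′ <? b))

-- The number of common in-neighbours of {x, b, b′} and {x, c, c′}: one for
-- each candidate {x, p, q} (p ∈ {b, b′}, q ∈ {c, c′}) such that the other
-- b-point is smaller than q and the other c-point is smaller than p.
cross-count : ∀ {v} → Fin v → Fin v → Fin v → Fin v → ℕ
cross-count b b′ c c′ = [ b′ <? c ] * [ c′ <? b ] + ([ b′ <? c′ ] * [ c <? b ] + ([ b <? c ] * [ c′ <? b′ ] + [ b <? c′ ] * [ c <? b′ ]))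

OrderKept : ∀ {v} → (Fin v → Fin v) → Fin v → Fin v → Set
OrderKept f p q = ([ p <? q ] ≡ [ f p <? f q ]) × ([ q <? p ] ≡ [ f q <? f p ])

cross-count-cong : ∀ {v} (f : Fin v → Fin v) {b b′ c c′} →
  OrderKept f b c → OrderKept f b c′ → OrderKept f b′ c → OrderKept f b′ c′ →
  cross-count b b′ c c′ ≡ cross-count (f b) (f b′) (f c) (f c′)
cross-count-cong f (bc , cb) (bc′ , c′b) (b′c , cb′) (b′c′ , c′b′) =
  cong₂ _+_ (cong₂ _*_ b′c c′b) (cong₂ _+_ (cong₂ _*_ b′c′ cb) (cong₂ _+_ (cong₂ _*_ bc c′b′) (cong₂ _*_ bc′ cb′)))

I-five-points : ∀ {v} {x b b′ c c′ : Fin v} → FiveDistinct x b b′ c c′ →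
  I ⁅ x , b , b′ ⁆ ⁅ x , c , c′ ⁆ ≡ cross-count b b′ c c′
I-five-points {v} {x} {b} {b′} {c} {c′} d = begin
  I B C                                       ≡⟨ length-filter (InBoth? B C) (allSubsets v) ⟩
  count (InBoth? B C)                         ≡⟨ count-candidates (InBoth? B C) (candidates d) (candidates-unique d) (in-neighbour-candidates d) ⟩
  Σl (λ Q → [ InBoth? B C Q ]) (candidates d) ≡⟨ cong₂ _+_ at-bc (cong₂ _+_ at-bc′ (cong₂ _+_ at-b′c (trans (+-identityʳ _) at-b′c′))) ⟩
  cross-count b b′ c c′                       ∎
  where
  open ≡-Reasoning
  B C : Subset v
  B = ⁅ x , b , b′ ⁆
  C = ⁅ x , c , c′ ⁆
  -- Each candidate is the {x, b, c} of a relabelled configuration.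
  at-bc : [ InBoth? B C ⁅ x , b , c ⁆ ] ≡ [ b′ <? c ] * [ c′ <? b ]
  at-bc = candidate-count d
  at-bc′ : [ InBoth? B C ⁅ x , b , c′ ⁆ ] ≡ [ b′ <? c′ ] * [ c <? b ]
  at-bc′ = trans (cong (λ C′ → [ InBoth? B C′ ⁅ x , b , c′ ⁆ ]) (triple-swap₂₃ x c c′)) (candidate-count (swap-c d))
  at-b′c : [ InBoth? B C ⁅ x , b′ , c ⁆ ] ≡ [ b <? c ] * [ c′ <? b′ ]
  at-b′c = trans (cong (λ B′ → [ InBoth? B′ C ⁅ x , b′ , c ⁆ ]) (triple-swap₂₃ x b b′)) (candidate-count (swap-b d))
  at-b′c′ : [ InBoth? B C ⁅ x , b′ , c′ ⁆ ] ≡ [ b <? c′ ] * [ c <? b′ ]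
  at-b′c′ = trans (cong₂ (λ B′ C′ → [ InBoth? B′ C′ ⁅ x , b′ , c′ ⁆ ]) (triple-swap₂₃ x b b′) (triple-swap₂₃ x c c′))
                  (candidate-count (swap-b (swap-c d)))

module _ {v} (i j : Fin v) where

  σ σ⁻¹ : Fin v → Fin v
  σ   = transposeᶠ i j
  σ⁻¹ = transposeᶠ j i

  mem-image : ∀ (B : Subset v) z → mem (B ^⟨ i ⟩⟨ j ⟩) z ≡ mem B (σ⁻¹ z)
  mem-image B z = lookup∘tabulate _ z

  σ-injective : ∀ {a b} → σ a ≡ σ b → a ≡ b
  σ-injective {a} {b} e = trans (sym (transpose-inverse j i)) (trans (cong σ⁻¹ e) (transpose-inverse j i))

  triple-image : ∀ a b c → ⁅ a , b , c ⁆ ^⟨ i ⟩⟨ j ⟩ ≡ ⁅ σ a , σ b , σ c ⁆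
  triple-image a b c = subset-ext λ z → begin
    mem (⁅ a , b , c ⁆ ^⟨ i ⟩⟨ j ⟩) z                 ≡⟨ mem-image ⁅ a , b , c ⁆ z ⟩
    mem ⁅ a , b , c ⁆ (σ⁻¹ z)                          ≡⟨ mem-triple a b c (σ⁻¹ z) ⟩
    eqb a (σ⁻¹ z) ∨ eqb b (σ⁻¹ z) ∨ eqb c (σ⁻¹ z)      ≡⟨ cong₂ _∨_ (moved a z) (cong₂ _∨_ (moved b z) (moved c z)) ⟩
    eqb (σ a) z ∨ eqb (σ b) z ∨ eqb (σ c) z            ≡⟨ sym (mem-triple (σ a) (σ b) (σ c) z) ⟩
    mem ⁅ σ a , σ b , σ c ⁆ z                          ∎
    where
    open ≡-Reasoning
    moved : ∀ a z → eqb a (σ⁻¹ z) ≡ eqb (σ a) z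
    moved a z = does-iff (λ e → trans (cong σ e) (transpose-inverse i j))
                         (λ e → trans (sym (transpose-inverse j i)) (cong σ⁻¹ e)) (a ≟ σ⁻¹ z) (σ a ≟ z)

  σ-cases : ∀ k → (k ≡ i × σ k ≡ j) ⊎ (k ≢ i × k ≡ j × σ k ≡ i) ⊎ (k ≢ i × k ≢ j × σ k ≡ k)
  σ-cases k with k ≟ i
  ... | yes k≡i = inj₁ (k≡i , refl)
  ... | no k≢i with k ≟ j
  ... | yes k≡j = inj₂ (inj₁ (k≢i , k≡j , refl))
  ... | no k≢j  = inj₂ (inj₂ (k≢i , k≢j , refl))

  module _ (adjacent : toℕ j ≡ suc (toℕ i)) where
    private
      i<j : i < j
      i<j = subst (toℕ i <ℕ_) (sym adjacent) (n<1+n (toℕ i))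

      -- No point lies strictly between i and j = i + 1.
      above-i : ∀ {c} → c ≢ j → i < c → j < c
      above-i {c} c≢j i<c = subst (_<ℕ toℕ c) (sym adjacent)
        (≤∧≢⇒< i<c (λ e → c≢j (toℕ-injective (trans (sym e) (sym adjacent)))))

      below-j : ∀ {a} → a ≢ i → a < j → a < i
      below-j {a} a≢i a<j = ≤∧≢⇒< (s≤s⁻¹ (subst (toℕ a <ℕ_) adjacent a<j)) (λ e → a≢i (toℕ-injective e))

      above-j : ∀ {c : Fin v} → j < c → i < c
      above-j = <-trans i<j

      below-i : ∀ {a : Fin v} → a < i → a < j
      below-i a<i = <-trans a<i i<j

    order-preserved : ∀ a c → (a ≡ i × c ≡ j) ⊎ (a ≡ j × c ≡ i) ⊎ ([ a <? c ] ≡ [ σ a <? σ c ])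
    order-preserved a c with a ≟ c
    ... | yes refl = inj₂ (inj₂ ([]-iff (λ a<a → ⊥-elim (<-irrefl refl a<a)) (λ σa<σa → ⊥-elim (<-irrefl refl σa<σa)) (a <? a) (σ a <? σ a)))
    ... | no a≢c with σ-cases a | σ-cases c
    ... | inj₁ (a≡i , _)               | inj₁ (c≡i , _)               = ⊥-elim (a≢c (trans a≡i (sym c≡i)))
    ... | inj₁ (a≡i , _)               | inj₂ (inj₁ (_ , c≡j , _))    = inj₁ (a≡i , c≡j)
    ... | inj₂ (inj₁ (_ , a≡j , _))    | inj₁ (c≡i , _)               = inj₂ (inj₁ (a≡j , c≡i))
    ... | inj₂ (inj₁ (_ , a≡j , _))    | inj₂ (inj₁ (_ , c≡j , _))    = ⊥-elim (a≢c (trans a≡j (sym c≡j)))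
    ... | inj₁ (refl , σa)             | inj₂ (inj₂ (_ , c≢j , σc))   = inj₂ (inj₂ ([]-iff
          (λ l → subst₂ _<_ (sym σa) (sym σc) (above-i c≢j l)) (λ l → above-j (subst₂ _<_ σa σc l)) (a <? c) (σ a <? σ c)))
    ... | inj₂ (inj₁ (_ , refl , σa)) | inj₂ (inj₂ (_ , c≢j , σc))   = inj₂ (inj₂ ([]-iff
          (λ l → subst₂ _<_ (sym σa) (sym σc) (above-j l)) (λ l → above-i c≢j (subst₂ _<_ σa σc l)) (a <? c) (σ a <? σ c)))
    ... | inj₂ (inj₂ (a≢i , _ , σa))  | inj₁ (refl , σc)             = inj₂ (inj₂ ([]-iff
          (λ l → subst₂ _<_ (sym σa) (sym σc) (below-i l)) (λ l → below-j a≢i (subst₂ _<_ σa σc l)) (a <? c) (σ a <? σ c)))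
    ... | inj₂ (inj₂ (a≢i , _ , σa))  | inj₂ (inj₁ (_ , refl , σc))  = inj₂ (inj₂ ([]-iff
          (λ l → subst₂ _<_ (sym σa) (sym σc) (below-j a≢i l)) (λ l → below-i (subst₂ _<_ σa σc l)) (a <? c) (σ a <? σ c)))
    ... | inj₂ (inj₂ (_ , _ , σa))    | inj₂ (inj₂ (_ , _ , σc))     = inj₂ (inj₂ ([]-iff
          (λ l → subst₂ _<_ (sym σa) (sym σc) l) (λ l → subst₂ _<_ σa σc l) (a <? c) (σ a <? σ c)))

    swapped-or-same : ∀ p q → (p ≡ i × q ≡ j) ⊎ (p ≡ j × q ≡ i) ⊎ OrderKept σ p q
    swapped-or-same p q with order-preserved p q | order-preserved q p
    ... | inj₁ pq            | _                  = inj₁ pq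
    ... | inj₂ (inj₁ pq)     | _                  = inj₂ (inj₁ pq)
    ... | inj₂ (inj₂ _)      | inj₁ (q≡i , p≡j)   = inj₂ (inj₁ (p≡j , q≡i))
    ... | inj₂ (inj₂ _)      | inj₂ (inj₁ (q≡j , p≡i)) = inj₁ (p≡i , q≡j)
    ... | inj₂ (inj₂ p<q)    | inj₂ (inj₂ q<p)    = inj₂ (inj₂ (p<q , q<p))

≡0-unless : ∀ {n} {X : Set} → (n ≢ 0 → X) → ¬ X → n ≡ 0
≡0-unless {zero}  _ _  = refl
≡0-unless {suc n} f ¬X = ⊥-elim (¬X (f λ ()))

SplitBy : ∀ {v} → Subset v → Subset v → Fin v → Fin v → Set
SplitBy {v} B C i i+1 = Σ (Fin v) λ x → Σ (Fin v) λ y → Σ (Fin v) λ z → y ≢ z ×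
  ((B ≡ ⁅ i , x , y ⁆ × C ≡ ⁅ i+1 , x , z ⁆) ⊎ (B ≡ ⁅ i+1 , x , z ⁆ × C ≡ ⁅ i , x , y ⁆))

module _ {v} (D : STS v) {B C : Subset v} (B-block : STS.IsBlock D B) (C-block : STS.IsBlock D C) (B≢C : B ≢ C) where
  open STS D

  one-common-point : ∀ {y z} → y ≢ z → mem B y ≡ true → mem C y ≡ true → mem B z ≡ true → mem C z ≢ true
  one-common-point {y} {z} y≢z y∈B y∈C z∈B z∈C =
    B≢C (unique y z y≢z B C B-block (mem⇒∈ y∈B) (mem⇒∈ z∈B) C-block (mem⇒∈ y∈C) (mem⇒∈ z∈C))

  intersection-singleton : ∀ {y} → mem B y ≡ true → mem C y ≡ true → B ∩ C ≡ ｛ y ｝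
  intersection-singleton {y} y∈B y∈C = subset-ext λ z → begin
    mem (B ∩ C) z        ≡⟨ mem-∩ B C z ⟩
    mem B z ∧ mem C z    ≡⟨ only-y z ⟩
    eqb y z              ≡⟨ sym (mem-⁅⁆ y z) ⟩
    mem ｛ y ｝ z          ∎
    where
    open ≡-Reasoning
    only-y : ∀ z → (mem B z ∧ mem C z) ≡ eqb y z
    only-y z with y ≟ z | mem B z in z∈B | mem C z in z∈C
    ... | yes refl | _     | _     = trans (sym (cong₂ _∧_ z∈B z∈C)) (cong₂ _∧_ y∈B y∈C)
    ... | no y≢z   | true  | true  = ⊥-elim (one-common-point y≢z y∈B y∈C z∈B z∈C)
    ... | no _     | true  | false = refl
    ... | no _     | false | _     = refl

  meeting-blocks : ∀ {x b b′ c c′} → B ≡ ⁅ x , b , b′ ⁆ → C ≡ ⁅ x , c , c′ ⁆ → FiveDistinct x b b′ c c′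
  meeting-blocks {x} {b} {b′} {c} {c′} refl refl = record
    { x≢b = x≢b ; x≢b′ = x≢b′ ; x≢c = x≢c ; x≢c′ = x≢c′ ; b≢b′ = b≢b′ ; c≢c′ = c≢c′
    ; b≢c = apart x≢b (triple-∋₂ x b b′) (triple-∋₂ x c c′)
    ; b≢c′ = apart x≢b (triple-∋₂ x b b′) (triple-∋₃ x c c′)
    ; b′≢c = apart x≢b′ (triple-∋₃ x b b′) (triple-∋₂ x c c′)
    ; b′≢c′ = apart x≢b′ (triple-∋₃ x b b′) (triple-∋₃ x c c′) }
    where
    B-distinct : x ≢ b × x ≢ b′ × b ≢ b′
    B-distinct = triple-distinct x b b′ (block-size _ B-block)
    C-distinct : x ≢ c × x ≢ c′ × c ≢ c′
    C-distinct = triple-distinct x c c′ (block-size _ C-block)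
    x≢b : x ≢ b
    x≢b = proj₁ B-distinct
    x≢b′ : x ≢ b′
    x≢b′ = proj₁ (proj₂ B-distinct)
    b≢b′ : b ≢ b′
    b≢b′ = proj₂ (proj₂ B-distinct)
    x≢c : x ≢ c
    x≢c = proj₁ C-distinct
    x≢c′ : x ≢ c′
    x≢c′ = proj₁ (proj₂ C-distinct)
    c≢c′ : c ≢ c′
    c≢c′ = proj₂ (proj₂ C-distinct)
    apart : ∀ {p q} → x ≢ p → mem ⁅ x , b , b′ ⁆ p ≡ true → mem ⁅ x , c , c′ ⁆ q ≡ true → p ≢ q
    apart x≢p p∈B q∈C refl = one-common-point x≢p (triple-∋₁ x b b′) (triple-∋₁ x c c′) p∈B q∈C

  -- Part (1): a common in-neighbour forces B and C to meet, hence in one point.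
  meet-in-one-point : I B C ≢ 0 → ∣ B ∩ C ∣ ≡ 1
  meet-in-one-point I≢0 = meet-once (I≢0⇒common-point B C I≢0)
    where
    meet-once : Meet B C → ∣ B ∩ C ∣ ≡ 1
    meet-once (y , y∈B , y∈C) = trans (cong ∣_∣ (intersection-singleton y∈B y∈C)) (∣⁅x⁆∣≡1 y)

  -- Part (2): with b < b′ and b < c < c′ the candidates {x,b,c} and
  -- {x,b,c′} drop out of cross-count, and the other two contribute
  -- [c′ < b′] and [c < b′].
  I-ordered : ∀ (x b b′ c c′ : Fin v) → B ≡ ⁅ x , b , b′ ⁆ → C ≡ ⁅ x , c , c′ ⁆ →
    b < b′ → b < c → c < c′ → I B C ≡ [ c <? b′ ] + [ c′ <? b′ ]
  I-ordered x b b′ c c′ eB eC b<b′ b<c c<c′ = begin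
    I B C                                  ≡⟨ cong₂ I eB eC ⟩
    I ⁅ x , b , b′ ⁆ ⁅ x , c , c′ ⁆         ≡⟨ I-five-points (meeting-blocks eB eC) ⟩
    cross-count b b′ c c′                  ≡⟨ cong₂ _+_ (cong ([ b′ <? c ] *_) ([]-no (<-asym b<c′) (c′ <? b)))
                                              (cong₂ _+_ (cong ([ b′ <? c′ ] *_) ([]-no (<-asym b<c) (c <? b)))
                                              (cong₂ _+_ (cong (_* [ c′ <? b′ ]) ([]-yes b<c (b <? c)))
                                                         (cong (_* [ c <? b′ ]) ([]-yes b<c′ (b <? c′))))) ⟩
    [ b′ <? c ] * 0 + ([ b′ <? c′ ] * 0 + (1 * [ c′ <? b′ ] + 1 * [ c <? b′ ]))
                                           ≡⟨ simplify [ b′ <? c ] [ b′ <? c′ ] [ c′ <? b′ ] [ c <? b′ ] ⟩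
    [ c <? b′ ] + [ c′ <? b′ ]             ∎
    where
    open ≡-Reasoning
    b<c′ : b < c′
    b<c′ = <-trans b<c c<c′
    simplify : ∀ p q r s → p * 0 + (q * 0 + (1 * r + 1 * s)) ≡ s + r
    simplify = solve-∀

  module _ (i j : Fin v) (adjacent : toℕ j ≡ suc (toℕ i)) where
    private
      Bσ Cσ : Subset v
      Bσ = B ^⟨ i ⟩⟨ j ⟩
      Cσ = C ^⟨ i ⟩⟨ j ⟩

    split-or-kept : ∀ {y p p′ q q′} → B ≡ ⁅ p , y , p′ ⁆ → C ≡ ⁅ q , y , q′ ⁆ → p′ ≢ q′ →
      SplitBy B C i j ⊎ OrderKept (σ i j) p q
    split-or-kept {y} {p} {p′} {q} {q′} eB eC p′≢q′ with swapped-or-same i j adjacent p q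
    ... | inj₁ (refl , refl)        = inj₁ (y , p′ , q′ , p′≢q′ , inj₁ (eB , eC))
    ... | inj₂ (inj₁ (refl , refl)) = inj₁ (y , q′ , p′ , ≢-sym p′≢q′ , inj₂ (eB , eC))
    ... | inj₂ (inj₂ kept)          = inj₂ kept

    -- Blocks through a common point y: either they are split by (i i+1), or
    -- all four b-c pairs keep their order and so I is unchanged.
    split-or-I-kept : ∀ {y b₁ b₂ c₁ c₂} → B ≡ ⁅ y , b₁ , b₂ ⁆ → C ≡ ⁅ y , c₁ , c₂ ⁆ → SplitBy B C i j ⊎ I B C ≡ I Bσ Cσ
    split-or-I-kept {y} {b₁} {b₂} {c₁} {c₂} eB eC
      with split-or-kept B₁ C₁ b₂≢c₂ | split-or-kept B₁ C₂ b₂≢c₁ | split-or-kept B₂ C₁ b₁≢c₂ | split-or-kept B₂ C₂ b₁≢c₁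
      where
      open FiveDistinct (meeting-blocks eB eC) renaming (b≢c to b₁≢c₁; b≢c′ to b₁≢c₂; b′≢c to b₂≢c₁; b′≢c′ to b₂≢c₂)
      B₁ : B ≡ ⁅ b₁ , y , b₂ ⁆
      B₁ = trans eB (triple-swap₁₂ y b₁ b₂)
      B₂ : B ≡ ⁅ b₂ , y , b₁ ⁆
      B₂ = trans eB (trans (triple-swap₂₃ y b₁ b₂) (triple-swap₁₂ y b₂ b₁))
      C₁ : C ≡ ⁅ c₁ , y , c₂ ⁆
      C₁ = trans eC (triple-swap₁₂ y c₁ c₂)
      C₂ : C ≡ ⁅ c₂ , y , c₁ ⁆
      C₂ = trans eC (trans (triple-swap₂₃ y c₁ c₂) (triple-swap₁₂ y c₂ c₁))
    ... | inj₁ split | _          | _          | _          = inj₁ split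
    ... | inj₂ _     | inj₁ split | _          | _          = inj₁ split
    ... | inj₂ _     | inj₂ _     | inj₁ split | _          = inj₁ split
    ... | inj₂ _     | inj₂ _     | inj₂ _     | inj₁ split = inj₁ split
    ... | inj₂ k₁₁   | inj₂ k₁₂   | inj₂ k₂₁   | inj₂ k₂₂   = inj₂ (begin
      I B C                                                 ≡⟨ cong₂ I eB eC ⟩
      I ⁅ y , b₁ , b₂ ⁆ ⁅ y , c₁ , c₂ ⁆                      ≡⟨ I-five-points d ⟩
      cross-count b₁ b₂ c₁ c₂                               ≡⟨ cross-count-cong (σ i j) k₁₁ k₁₂ k₂₁ k₂₂ ⟩
      cross-count (σ i j b₁) (σ i j b₂) (σ i j c₁) (σ i j c₂) ≡⟨ sym (I-five-points (map-five (σ-injective i j) d)) ⟩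
      I ⁅ σ i j y , σ i j b₁ , σ i j b₂ ⁆ ⁅ σ i j y , σ i j c₁ , σ i j c₂ ⁆
                                                            ≡⟨ sym (cong₂ I (image eB) (image eC)) ⟩
      I Bσ Cσ                                               ∎)
      where
      open ≡-Reasoning
      d : FiveDistinct y b₁ b₂ c₁ c₂
      d = meeting-blocks eB eC
      image : ∀ {S a b c} → S ≡ ⁅ a , b , c ⁆ → S ^⟨ i ⟩⟨ j ⟩ ≡ ⁅ σ i j a , σ i j b , σ i j c ⁆
      image {a = a} {b} {c} refl = triple-image i j a b c

    -- Part (3): if the transposition changes I, then B and C meet (else both
    -- counts vanish), and the only way to change I is to split them.
    I-changed⇒split : I B C ≢ I Bσ Cσ → SplitBy B C i j
    I-changed⇒split I≢Iσ = by-meeting (meet? B C)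
      where
      preimage : Meet Bσ Cσ → Meet B C
      preimage (z , z∈Bσ , z∈Cσ) = σ⁻¹ i j z , trans (sym (mem-image i j B z)) z∈Bσ , trans (sym (mem-image i j C z)) z∈Cσ
      by-meeting : Dec (Meet B C) → SplitBy B C i j
      by-meeting (no disjoint) = ⊥-elim (I≢Iσ (trans (≡0-unless (I≢0⇒common-point B C) disjoint)
                                                  (sym (≡0-unless (λ ne → preimage (I≢0⇒common-point Bσ Cσ ne)) disjoint))))
      by-meeting (yes (y , y∈B , y∈C)) =
        through-y (triple-decompose B y (block-size B B-block) y∈B) (triple-decompose C y (block-size C C-block) y∈C)
        where
        through-y : Σ (Fin v) (λ b₁ → Σ (Fin v) λ b₂ → y ≢ b₁ × y ≢ b₂ × b₁ ≢ b₂ × B ≡ ⁅ y , b₁ , b₂ ⁆) →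
                    Σ (Fin v) (λ c₁ → Σ (Fin v) λ c₂ → y ≢ c₁ × y ≢ c₂ × c₁ ≢ c₂ × C ≡ ⁅ y , c₁ , c₂ ⁆) → SplitBy B C i j
        through-y (_ , _ , _ , _ , _ , eB) (_ , _ , _ , _ , _ , eC) = [ id , (λ I≡Iσ → ⊥-elim (I≢Iσ I≡Iσ)) ]′ (split-or-I-kept eB eC)

lemma6p3 : ∀ {v} (D : STS v) (B C : Subset v) →
             STS.IsBlock D B → STS.IsBlock D C → B ≢ C →
             (I B C ≢ 0 → ∣ B ∩ C ∣ ≡ 1)
             × (∀ (x b b′ c c′ : Fin v) → B ≡ ⁅ x , b , b′ ⁆ → C ≡ ⁅ x , c , c′ ⁆ →
                  b < b′ → b < c → c < c′ →
                  I B C ≡ [ c <? b′ ] + [ c′ <? b′ ])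
             × (∀ (i i+1 : Fin v) → toℕ i+1 ≡ suc (toℕ i) →
                  I B C ≢ I (B ^⟨ i ⟩⟨ i+1 ⟩) (C ^⟨ i ⟩⟨ i+1 ⟩) →
                  Σ (Fin v) λ x → Σ (Fin v) λ y → Σ (Fin v) λ z → y ≢ z ×
                    ((B ≡ ⁅ i , x , y ⁆ × C ≡ ⁅ i+1 , x , z ⁆)
                     ⊎ (B ≡ ⁅ i+1 , x , z ⁆ × C ≡ ⁅ i , x , y ⁆)))
lemma6p3 D B C B-block C-block B≢C =
    meet-in-one-point D B-block C-block B≢C
  , I-ordered D B-block C-block B≢C
  , λ i i+1 adjacent → I-changed⇒split D B-block C-block B≢C i i+1 adjacent
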